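{- The category whose objects are object-free categories and whose arrows are relational morphisms is isomorphic to the category whose objects are algebraic object-free categories and whose arrows are algebraic morphisms; likewise, the category of object-free categories with bounded relational morphisms is isomorphic to the category of algebraic object-free categories with bounded algebraic morphisms. (The isomorphism sends $(X,R)$ to $(X,\cdot,D)$ with $D^y_z\iff\exists x.\ R^x_{yz}$ and $x\cdot y$ the unique $z$ with $R^z_{xy}$; conversely $(S,\cdot,D)$ is sent to $(S,R)$ with $R^x_{yz}\iff D^y_z\wedge x=y\cdot z$; maps are unchanged.)
   Context: For a ternary relation $R\subseteq X\times X\times X$ write $R^x_{yz}$ for $(x,y,z)\in R$, and $D^y_z\iff\exists x.\ R^x_{yz}$. $R$ is a partial operation if for all $y,z$ there is at most one $x$ with $R^x_{yz}$; relationally associative if $(\exists v.\ R^u_{xv}\wedge R^v_{yz})\iff(\exists v.\ R^u_{vz}\wedge R^v_{xy})$ for all $u,x,y,z$; coherent if $R^v_{xy}\wedge D^y_z\Rightarrow D^v_z$ for all $v,x,y,z$. $e$ is a relational left unit if $\exists x.\ R^x_{ex}$ and $\forall x,y.\ R^y_{ex}\Rightarrow y=x$; a relational right unit if $\exists x.\ R^x_{xe}$ and $\forall x,y.\ R^y_{xe}\Rightarrow y=x$; $E$ is the set of relational left or right units. An object-free category is $(X,R)$ with $R$ a relationally associative, coherent partial operation such that every $x$ has $e,e'\in E$ with $D^e_x$ and $D^x_{e'}$. A relational morphism $f:(X,R)\to(X',R')$ is a function $f:X\to X'$ with $R^x_{yz}\Rightarrow R'^{f x}_{(f y)(f z)}$;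 it is bounded if moreover $R'^{f x}_{vw}\Rightarrow\exists y,z.\ v=f y\wedge w=f z\wedge R^x_{yz}$. An algebraic object-free category is a triple $(S,\cdot,D)$ with $D\subseteq S\times S$ (write $D^x_y$ for $(x,y)\in D$) and $\cdot:D\to S$ such that, letting $E$ be the set of algebraic units ($e$ is a left unit if some $x$ has $D^e_x$ and $e\cdot x=x$ whenever $D^e_x$; a right unit if some $x$ has $D^x_e$ and $x\cdot e=x$ whenever $D^x_e$; a unit if it is a left or right unit), for all $x,y,z$: $D^x_y\wedge D^{x\cdot y}_z\iff D^y_z\wedge D^x_{y\cdot z}$; $D^x_y\wedge D^{x\cdot y}_z\Rightarrow(x\cdot y)\cdot z=x\cdot(y\cdot z)$; every $x$ has $e,e'\in E$ with $D^e_x$ and $D^x_{e'}$; and $D^x_y\wedge D^y_z\Rightarrow D^{x\cdot y}_z$. An algebraic morphism $f:(S,\cdot,D)\to(S',\cdot',D')$ is a function with $D^x_y\Rightarrow D'^{f x}_{f y}$ and $f(x\cdot y)=f x\cdot' f y$ whenever $D^x_y$; it is bounded if whenever $D'^u_v$ and $f x=u\cdot' v$ there exist $y,z$ with $f y=u$, $f z=v$, $D^y_z$ and $x=y\cdot z$. -}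

module Defs where

open import Data.Product using (Σ; Σ-syntax; ∃; _×_; _,_; proj₁)
open import Data.Sum using (_⊎_)
open import Relation.Binary.PropositionalEquality using (_≡_)
open import Function.Bundles using (_⇔_)

-- Relational side: a ternary relation R, with  R x y z  meaning  R^x_{yz}

Rel3 : Set → Set₁
Rel3 X = X → X → X → Set

module _ {X : Set} (R : Rel3 X) where

  Dom : X → X → Set
  Dom y z = Σ[ x ∈ X ] R x y z

  IsPartialOp : Set
  IsPartialOp = ∀ {x x′ y z} → R x y z → R x′ y z → x ≡ x′

  RelAssociative : Set
  RelAssociative = ∀ u x y z →
    (Σ[ v ∈ X ] (R u x v × R v y z)) ⇔ (Σ[ v ∈ X ] (R u v z × R v x y))

  Coherent : Set
  Coherent = ∀ {v x y z} → R v x y → Dom y z → Dom v z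

  RelLeftUnit : X → Set
  RelLeftUnit e = (Σ[ x ∈ X ] R x e x) × (∀ x y → R y e x → y ≡ x)

  RelRightUnit : X → Set
  RelRightUnit e = (Σ[ x ∈ X ] R x x e) × (∀ x y → R y x e → y ≡ x)

  RelUnit : X → Set
  RelUnit e = RelLeftUnit e ⊎ RelRightUnit e

  record IsOFC : Set where
    field
      partial   : IsPartialOp
      assoc     : RelAssociative
      coherent  : Coherent
      unitsL    : ∀ x → Σ[ e ∈ X ] (RelUnit e × Dom e x)
      unitsR    : ∀ x → Σ[ e′ ∈ X ] (RelUnit e′ × Dom x e′)

record AlgStr (S : Set) : Set₁ where
  field
    D  : S → S → Set
    op : (x y : S) → D x y → S

module _ {S : Set} (A : AlgStr S) where
  open AlgStr A

  AlgLeftUnit : S → Set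
  AlgLeftUnit e = (Σ[ x ∈ S ] D e x) × (∀ x (d : D e x) → op e x d ≡ x)

  AlgRightUnit : S → Set
  AlgRightUnit e = (Σ[ x ∈ S ] D x e) × (∀ x (d : D x e) → op x e d ≡ x)

  AlgUnit : S → Set
  AlgUnit e = AlgLeftUnit e ⊎ AlgRightUnit e

  record IsAOFC : Set where
    field
      -- "·" is a function on the subset D: it does not depend on the
      -- membership witness
      op-irrelevant : ∀ x y (d d′ : D x y) → op x y d ≡ op x y d′
      dom-assoc : ∀ x y z →
        (Σ[ d ∈ D x y ] D (op x y d) z) ⇔ (Σ[ d ∈ D y z ] D x (op y z d))
      assoc : ∀ x y z (d₁ : D x y) (d₂ : D (op x y d₁) z)
                (d₃ : D y z) (d₄ : D x (op y z d₃)) →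
              op (op x y d₁) z d₂ ≡ op x (op y z d₃) d₄
      unitsL : ∀ x → Σ[ e ∈ S ] (AlgUnit e × D e x)
      unitsR : ∀ x → Σ[ e′ ∈ S ] (AlgUnit e′ × D x e′)
      coherent : ∀ x y z (d : D x y) → D y z → D (op x y d) z

toAlg : {X : Set} → Rel3 X → AlgStr X
toAlg R = record { D = Dom R ; op = λ y z d → proj₁ d }

toRel : {S : Set} → AlgStr S → Rel3 S
toRel A x y z = Σ[ d ∈ AlgStr.D A y z ] (x ≡ AlgStr.op A y z d)

RelMorphism : {X X′ : Set} → Rel3 X → Rel3 X′ → (X → X′) → Set
RelMorphism R R′ f = ∀ x y z → R x y z → R′ (f x) (f y) (f z)

BoundedRelMorphism : {X X′ : Set} → Rel3 X → Rel3 X′ → (X → X′) → Set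
BoundedRelMorphism {X} R R′ f =
  RelMorphism R R′ f ×
  (∀ x v w → R′ (f x) v w →
     Σ[ y ∈ X ] Σ[ z ∈ X ] (v ≡ f y × w ≡ f z × R x y z))

AlgMorphism : {S S′ : Set} → AlgStr S → AlgStr S′ → (S → S′) → Set
AlgMorphism A A′ f =
  Σ[ pres ∈ (∀ x y → D x y → D′ (f x) (f y)) ]
    (∀ x y (d : D x y) → f (op x y d) ≡ op′ (f x) (f y) (pres x y d))
  where
  open AlgStr A
  open AlgStr A′ renaming (D to D′; op to op′)

BoundedAlgMorphism : {S S′ : Set} → AlgStr S → AlgStr S′ → (S → S′) → Set
BoundedAlgMorphism {S} A A′ f =
  AlgMorphism A A′ f ×
  (∀ u v x (d′ : D′ u v) → f x ≡ op′ u v d′ →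
     Σ[ y ∈ S ] Σ[ z ∈ S ] Σ[ d ∈ D y z ] (f y ≡ u × f z ≡ v × x ≡ op y z d))
  where
  open AlgStr A
  open AlgStr A′ renaming (D to D′; op to op′)

{-# OPTIONS --safe #-}
module Submission where

open import Defs
open import Data.Product using (Σ-syntax; _×_; _,_; proj₁; proj₂; map₁; map₂)
open import Data.Sum using () renaming (map to map-⊎)
open import Function.Bundles using (_⇔_; mk⇔; Equivalence)
open import Relation.Binary.PropositionalEquality using (_≡_; refl; sym; trans; cong; subst)

-- A partial operation is the same thing as its graph, so every axiom and every
-- morphism condition on one side translates clause by clause into the other.
-- The only genuine work is associativity: relational associativity only says
-- that the two bracketings are defined together, and partiality of R is what
-- turns this into the equation (x·y)·z = x·(y·z). The correspondence of arrows
-- and the round trips hold without any axioms, except that recovering · from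
-- its graph needs · to ignore the domain witness.

module _ {X : Set} {R : Rel3 X} where

  RelLeftUnit⇒AlgLeftUnit : ∀ {e} → RelLeftUnit R e → AlgLeftUnit (toAlg R) e
  RelLeftUnit⇒AlgLeftUnit ((x , r) , unique) =
    (x , x , r) , λ y (z , r′) → unique y z r′

  RelRightUnit⇒AlgRightUnit : ∀ {e} → RelRightUnit R e → AlgRightUnit (toAlg R) e
  RelRightUnit⇒AlgRightUnit ((x , r) , unique) =
    (x , x , r) , λ y (z , r′) → unique y z r′

  RelUnit⇒AlgUnit : ∀ {e} → RelUnit R e → AlgUnit (toAlg R) e
  RelUnit⇒AlgUnit = map-⊎ RelLeftUnit⇒AlgLeftUnit RelRightUnit⇒AlgRightUnit

  Dom-assoc : RelAssociative R → ∀ x y z →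
    (Σ[ d ∈ Dom R x y ] Dom R (proj₁ d) z) ⇔ (Σ[ d ∈ Dom R y z ] Dom R x (proj₁ d))
  Dom-assoc assoc x y z = mk⇔ rebracketʳ rebracketˡ
    where
    rebracketʳ : Σ[ d ∈ Dom R x y ] Dom R (proj₁ d) z → Σ[ d ∈ Dom R y z ] Dom R x (proj₁ d)
    rebracketʳ ((v , rv) , (u , ru)) =
      let (w , ruw , rw) = Equivalence.from (assoc u x y z) (v , ru , rv)
      in (w , rw) , (u , ruw)
    rebracketˡ : Σ[ d ∈ Dom R y z ] Dom R x (proj₁ d) → Σ[ d ∈ Dom R x y ] Dom R (proj₁ d) z
    rebracketˡ ((w , rw) , (u , ruw)) =
      let (v , ruv , rv) = Equivalence.to (assoc u x y z) (w , ruw , rw)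
      in (v , rv) , (u , ruv)

  bracketings-agree : IsPartialOp R → RelAssociative R →
    ∀ {x y z u u′ v w} → R v x y → R u v z → R w y z → R u′ x w → u ≡ u′
  bracketings-agree partial assoc {x} {y} {z} {u} rv ru rw ru′ =
    let (w′ , ruw′ , rw′) = Equivalence.from (assoc u x y z) (_ , ru , rv)
    in partial (subst (R u x) (partial rw′ rw) ruw′) ru′

  toAlg-isAOFC : IsOFC R → IsAOFC (toAlg R)
  toAlg-isAOFC H = record
    { op-irrelevant = λ x y (_ , r) (_ , r′) → partial r r′
    ; dom-assoc     = Dom-assoc assoc
    ; assoc         = λ x y z (_ , rv) (_ , ru) (_ , rw) (_ , ru′) →
                        bracketings-agree partial assoc rv ru rw ru′
    ; unitsL        = λ x → map₂ (map₁ RelUnit⇒AlgUnit) (unitsL x)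
    ; unitsR        = λ x → map₂ (map₁ RelUnit⇒AlgUnit) (unitsR x)
    ; coherent      = λ x y z (_ , r) → coherent r
    }
    where open IsOFC H

module _ {S : Set} {A : AlgStr S} where
  open AlgStr A

  AlgLeftUnit⇒RelLeftUnit : ∀ {e} → AlgLeftUnit A e → RelLeftUnit (toRel A) e
  AlgLeftUnit⇒RelLeftUnit ((x , d) , unit) =
    (x , d , sym (unit x d)) , λ { y _ (d′ , refl) → unit y d′ }

  AlgRightUnit⇒RelRightUnit : ∀ {e} → AlgRightUnit A e → RelRightUnit (toRel A) e
  AlgRightUnit⇒RelRightUnit ((x , d) , unit) =
    (x , d , sym (unit x d)) , λ { y _ (d′ , refl) → unit y d′ }

  AlgUnit⇒RelUnit : ∀ {e} → AlgUnit A e → RelUnit (toRel A) e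
  AlgUnit⇒RelUnit = map-⊎ AlgLeftUnit⇒RelLeftUnit AlgRightUnit⇒RelRightUnit

  module _ (H : IsAOFC A) where
    open IsAOFC H

    toRel-assoc : RelAssociative (toRel A)
    toRel-assoc u x y z = mk⇔ rebracketˡ rebracketʳ
      where
      rebracketˡ : Σ[ v ∈ S ] (toRel A u x v × toRel A v y z) →
                   Σ[ v ∈ S ] (toRel A u v z × toRel A v x y)
      rebracketˡ (_ , (dx , u≡x·v) , (dyz , refl)) =
        let (dxy , dz) = Equivalence.from (dom-assoc x y z) (dyz , dx)
        in op x y dxy , (dz , trans u≡x·v (sym (assoc x y z dxy dz dyz dx))) , (dxy , refl)
      rebracketʳ : Σ[ v ∈ S ] (toRel A u v z × toRel A v x y) →
                   Σ[ v ∈ S ] (toRel A u x v × toRel A v y z)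
      rebracketʳ (_ , (dz , u≡v·z) , (dxy , refl)) =
        let (dyz , dx) = Equivalence.to (dom-assoc x y z) (dxy , dz)
        in op y z dyz , (dx , trans u≡v·z (assoc x y z dxy dz dyz dx)) , (dyz , refl)

    toRel-isOFC : IsOFC (toRel A)
    toRel-isOFC = record
      { partial  = λ { (d , refl) (d′ , refl) → op-irrelevant _ _ d d′ }
      ; assoc    = toRel-assoc
      ; coherent = λ { (d , refl) (_ , d′ , _) → _ , coherent _ _ _ d d′ , refl }
      ; unitsL   = λ x → let (e , unit , d) = unitsL x in e , AlgUnit⇒RelUnit unit , (_ , d , refl)
      ; unitsR   = λ x → let (e , unit , d) = unitsR x in e , AlgUnit⇒RelUnit unit , (_ , d , refl)
      }

    toAlg∘toRel-op : ∀ x y d d′ → AlgStr.op (toAlg (toRel A)) x y d ≡ op x y d′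
    toAlg∘toRel-op x y (_ , d , refl) d′ = op-irrelevant x y d d′

  toAlg∘toRel-D : ∀ x y → AlgStr.D (toAlg (toRel A)) x y ⇔ D x y
  toAlg∘toRel-D x y = mk⇔ (λ (_ , d , _) → d) (λ d → _ , d , refl)

toRel∘toAlg : ∀ {X : Set} (R : Rel3 X) x y z → toRel (toAlg R) x y z ⇔ R x y z
toRel∘toAlg R x y z = mk⇔ (λ { ((_ , r) , refl) → r }) (λ r → (x , r) , refl)

module _ {X X′ : Set} (R : Rel3 X) (R′ : Rel3 X′) (f : X → X′) where

  relMorphism⇔toAlg : RelMorphism R R′ f ⇔ AlgMorphism (toAlg R) (toAlg R′) f
  relMorphism⇔toAlg = mk⇔ toAlgMorphism toRelMorphism
    where
    toAlgMorphism : RelMorphism R R′ f → AlgMorphism (toAlg R) (toAlg R′) f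
    toAlgMorphism m = (λ x y (w , r) → f w , m w x y r) , λ x y _ → refl
    toRelMorphism : AlgMorphism (toAlg R) (toAlg R′) f → RelMorphism R R′ f
    toRelMorphism (pres , hom) x y z r =
      subst (λ t → R′ t (f y) (f z)) (sym (hom y z (x , r))) (proj₂ (pres y z (x , r)))

  boundedRelMorphism⇔toAlg :
    BoundedRelMorphism R R′ f ⇔ BoundedAlgMorphism (toAlg R) (toAlg R′) f
  boundedRelMorphism⇔toAlg = mk⇔ toBoundedAlg toBoundedRel
    where
    open Equivalence relMorphism⇔toAlg using (to; from)
    toBoundedAlg : BoundedRelMorphism R R′ f → BoundedAlgMorphism (toAlg R) (toAlg R′) f
    toBoundedAlg (m , bounded) = to m , λ { u v x (_ , r′) refl →
      let (y , z , u≡fy , v≡fz , r) = bounded x u v r′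
      in y , z , (x , r) , sym u≡fy , sym v≡fz , refl }
    toBoundedRel : BoundedAlgMorphism (toAlg R) (toAlg R′) f → BoundedRelMorphism R R′ f
    toBoundedRel (m , bounded) = from m , λ x v w r′ →
      let (y , z , (t , r) , fy≡v , fz≡w , x≡t) = bounded v w x (f x , r′) refl
      in y , z , sym fy≡v , sym fz≡w , subst (λ s → R s y z) (sym x≡t) r

module _ {S S′ : Set} (A : AlgStr S) (A′ : AlgStr S′) (f : S → S′) where
  open AlgStr A

  algMorphism⇔toRel : AlgMorphism A A′ f ⇔ RelMorphism (toRel A) (toRel A′) f
  algMorphism⇔toRel = mk⇔ toRelMorphism toAlgMorphism
    where
    toRelMorphism : AlgMorphism A A′ f → RelMorphism (toRel A) (toRel A′) f
    toRelMorphism (pres , hom) x y z (d , x≡y·z) = pres y z d , trans (cong f x≡y·z) (hom y z d)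
    toAlgMorphism : RelMorphism (toRel A) (toRel A′) f → AlgMorphism A A′ f
    toAlgMorphism m = (λ x y d → proj₁ (m (op x y d) x y (d , refl)))
                    , (λ x y d → proj₂ (m (op x y d) x y (d , refl)))

  boundedAlgMorphism⇔toRel :
    BoundedAlgMorphism A A′ f ⇔ BoundedRelMorphism (toRel A) (toRel A′) f
  boundedAlgMorphism⇔toRel = mk⇔ toBoundedRel toBoundedAlg
    where
    open Equivalence algMorphism⇔toRel using (to; from)
    toBoundedRel : BoundedAlgMorphism A A′ f → BoundedRelMorphism (toRel A) (toRel A′) f
    toBoundedRel (m , bounded) = to m , λ x v w (d′ , fx≡v·w) →
      let (y , z , d , fy≡v , fz≡w , x≡y·z) = bounded v w x d′ fx≡v·w
      in y , z , sym fy≡v , sym fz≡w , (d , x≡y·z)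
    toBoundedAlg : BoundedRelMorphism (toRel A) (toRel A′) f → BoundedAlgMorphism A A′ f
    toBoundedAlg (m , bounded) = from m , λ u v x d′ fx≡u·v →
      let (y , z , u≡fy , v≡fz , (d , x≡y·z)) = bounded x u v (d′ , fx≡u·v)
      in y , z , d , sym u≡fy , sym v≡fz , x≡y·z

proposition3p7 :
    -- object maps are well defined
    (∀ {X : Set} (R : Rel3 X) → IsOFC R → IsAOFC (toAlg R))
    × (∀ {S : Set} (A : AlgStr S) → IsAOFC A → IsOFC (toRel A))
    -- they are mutually inverse (relations compared extensionally)
    × (∀ {X : Set} (R : Rel3 X) → IsOFC R →
         ∀ x y z → toRel (toAlg R) x y z ⇔ R x y z)
    × (∀ {S : Set} (A : AlgStr S) → IsAOFC A →
         (∀ x y → AlgStr.D (toAlg (toRel A)) x y ⇔ AlgStr.D A x y)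
         × (∀ x y d d′ → AlgStr.op (toAlg (toRel A)) x y d ≡ AlgStr.op A x y d′))
    -- arrows are unchanged: the same map is a (bounded) relational morphism
    -- iff it is a (bounded) algebraic morphism between the corresponding objects
    × (∀ {X X′ : Set} (R : Rel3 X) (R′ : Rel3 X′) → IsOFC R → IsOFC R′ →
         (f : X → X′) →
         (RelMorphism R R′ f ⇔ AlgMorphism (toAlg R) (toAlg R′) f)
         × (BoundedRelMorphism R R′ f ⇔ BoundedAlgMorphism (toAlg R) (toAlg R′) f))
    × (∀ {S S′ : Set} (A : AlgStr S) (A′ : AlgStr S′) → IsAOFC A → IsAOFC A′ →
         (f : S → S′) →
         (AlgMorphism A A′ f ⇔ RelMorphism (toRel A) (toRel A′) f)
         × (BoundedAlgMorphism A A′ f ⇔ BoundedRelMorphism (toRel A) (toRel A′) f))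
proposition3p7 =
    (λ R → toAlg-isAOFC)
  , (λ A → toRel-isOFC)
  , (λ R _ → toRel∘toAlg R)
  , (λ A H → toAlg∘toRel-D , toAlg∘toRel-op H)
  , (λ R R′ _ _ f → relMorphism⇔toAlg R R′ f , boundedRelMorphism⇔toAlg R R′ f)
  , (λ A A′ _ _ f → algMorphism⇔toRel A A′ f , boundedAlgMorphism⇔toRel A A′ f)
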